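{- Let $G$ be a finite bipartite graph with parts $A$ and $B$. Suppose there are partitions $A = A_1 \cup \cdots \cup A_k$ and $B = B_1 \cup \cdots \cup B_l$ such that for every $i \in [k]$ and $j \in [l]$, in the bipartite subgraph $G[A_i, B_j]$ induced by $A_i \cup B_j$ all vertices of $A_i$ have the same degree and all vertices of $B_j$ have the same degree. Let $H$ be the bipartite graph on the same vertex set $A \cup B$ obtained from $G$ by replacing every $G[A_i,B_j]$ that contains at least one edge by the complete bipartite graph between $A_i$ and $B_j$ (and leaving $G[A_i,B_j]$ with no edges unchanged). Then $G$ has a perfect matching if and only if $H$ has a perfect matching. -}

module Defs where

open import Data.Nat using (ℕ; zero; suc)
open import Data.Fin using (Fin; zero; suc; _≟_)
open import Data.Bool using (Bool; true; false; _∧_; if_then_else_)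
open import Data.Product using (Σ; ∃; ∃-syntax; _×_)
open import Relation.Binary.PropositionalEquality using (_≡_)
open import Relation.Nullary using (does)

-- A finite bipartite graph with parts A = Fin m and B = Fin n is given by
-- its (decidable) adjacency relation  E : Fin m → Fin n → Bool.

count : {n : ℕ} → (Fin n → Bool) → ℕ
count {zero}  p = zero
count {suc n} p = if p zero then suc (count (λ y → p (suc y))) else count (λ y → p (suc y))

-- degree of x ∈ A inside G[A_i, B_j] (only depends on j for x ∈ A_i):
-- number of neighbours of x lying in B_j, where b : B → Fin l is the partition of B
degA : {m n l : ℕ} → (Fin m → Fin n → Bool) → (Fin n → Fin l) → Fin m → Fin l → ℕ
degA E b x j = count (λ y → does (b y ≟ j) ∧ E x y)

degB : {m n k : ℕ} → (Fin m → Fin n → Bool) → (Fin m → Fin k) → Fin n → Fin k → ℕ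
degB E a y i = count (λ x → does (a x ≟ i) ∧ E x y)

BlockBiregular : {m n k l : ℕ} → (Fin m → Fin n → Bool) → (Fin m → Fin k) → (Fin n → Fin l) → Set
BlockBiregular {m} {n} {k} {l} E a b =
  (∀ (i : Fin k) (j : Fin l) (x x′ : Fin m) → a x ≡ i → a x′ ≡ i → degA E b x j ≡ degA E b x′ j)
  × (∀ (i : Fin k) (j : Fin l) (y y′ : Fin n) → b y ≡ j → b y′ ≡ j → degB E a y i ≡ degB E a y′ i)

-- adjacency of the graph H: x ∈ A_i and y ∈ B_j are adjacent in H iff G[A_i, B_j]
-- contains at least one edge (then it is replaced by the complete bipartite graph)
HAdj : {m n k l : ℕ} → (Fin m → Fin n → Bool) → (Fin m → Fin k) → (Fin n → Fin l) → Fin m → Fin n → Set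
HAdj {m} {n} E a b x y = ∃[ x′ ] ∃[ y′ ] (a x′ ≡ a x × b y′ ≡ b y × E x′ y′ ≡ true)

PerfectMatching : {m n : ℕ} → (Fin m → Fin n → Set) → Set₁
PerfectMatching {m} {n} R =
  Σ (Fin m → Fin n → Set) λ M →
      (∀ x y → M x y → R x y)
    × (∀ (x : Fin m) → ∃[ y ] (M x y × (∀ y′ → M x y′ → y′ ≡ y)))
    × (∀ (y : Fin n) → ∃[ x ] (M x y × (∀ x′ → M x′ y → x′ ≡ x)))

GAdj : {m n : ℕ} → (Fin m → Fin n → Bool) → Fin m → Fin n → Set
GAdj E x y = E x y ≡ true

module Submission where

-- Lemma 2.1.  G ⊆ H, so a perfect matching of G is one of H.  Conversely, a
-- perfect matching of H is a bijection σ : A → B with x and σ x H-adjacent,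
-- i.e. lying in blocks A_i, B_j such that G[A_i, B_j] has an edge.  Fix S ⊆ A;
-- write s_i = |S ∩ A_i|, r_i = |A_i|, τ_j = |N_G(S) ∩ B_j|, c_j = |B_j|.
-- Double counting the edges of a biregular block with an edge gives the
-- density inequality s_i / r_i ≤ τ_j / c_j.  Weighting each vertex by the
-- density of its class (scaled by (m+n)! to stay in ℕ) and reindexing along σ,
--   |S| = Σ_{x ∈ A} s_{a x} / r_{a x} ≤ Σ_{y ∈ B} τ_{b y} / c_{b y} = |N_G(S)|,
-- which is Hall's condition for G.  Since |A| = |B|, Hall's theorem then
-- yields a perfect matching of G.

open import Defs
open import Data.Nat using (ℕ; zero; suc; _+_; _*_; _≤_; _<_; z≤n; s≤s; _≤?_; _<?_; _!; >-nonZero)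
open import Data.Nat.Properties hiding (_≟_)
open import Data.Nat.DivMod using (_/_; m/n*n≡m)
open import Data.Nat.Divisibility using (∣-trans; m∣m*n; m≤n⇒m!∣n!)
open import Data.Nat.Solver using (module +-*-Solver)
open import Data.Fin using (Fin; zero; suc; _≟_; punchOut; cast)
open import Data.Fin.Properties using (any?; all?; injective⇒≤; punchOut-injective)
open import Data.Fin.Subset.Properties using (anySubset?)
open import Data.Fin.Permutation using (Permutation; permutation; _⟨$⟩ʳ_; _⟨$⟩ˡ_; inverseˡ; inverseʳ; ↔⇒≡)
open import Data.Vec using (lookup; tabulate)
open import Data.Vec.Properties using (lookup∘tabulate)
open import Data.Bool using (Bool; true; false; _∧_; _∨_; not; if_then_else_)
open import Data.Bool.Properties using (∧-conicalˡ; ∧-conicalʳ; ¬-not) renaming (_≟_ to _≟ᵇ_)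
open import Data.Product using (Σ; ∃; ∃-syntax; _×_; _,_; proj₁; proj₂)
open import Data.Sum using (_⊎_; inj₁; inj₂)
open import Data.Empty using (⊥; ⊥-elim)
open import Function using (_∘_)
open import Function.Definitions using (Injective)
open import Relation.Binary.PropositionalEquality using (_≡_; refl; sym; trans; cong; cong₂; subst; subst₂; module ≡-Reasoning)
open import Relation.Nullary using (Dec; yes; no; ¬_; does; contradiction)
open import Relation.Nullary.Decidable using (dec-true; _×-dec_; _→-dec_)
open import Algebra.Properties.Semiring.Sum +-*-semiring
  using (sum-syntax; sum-replicate-zero; ∑-comm; ∑-distrib-+; *-distribˡ-sum; *-distribʳ-sum; sum-cong-≗; ∑-permute)

_∈_ : ∀ {n} → Fin n → (Fin n → Bool) → Set
x ∈ P = P x ≡ true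

_⊆_ : ∀ {n} → (Fin n → Bool) → (Fin n → Bool) → Set
P ⊆ Q = ∀ x → x ∈ P → x ∈ Q

infix  4 _∈_ _⊆_
infixr 7 _∩_
infixr 6 _∪_ _─_

_∩_ _∪_ _─_ : ∀ {n} → (Fin n → Bool) → (Fin n → Bool) → Fin n → Bool
(P ∩ Q) x = P x ∧ Q x
(P ∪ Q) x = P x ∨ Q x
(P ─ Q) x = P x ∧ not (Q x)

⁅_⁆ : ∀ {n} → Fin n → Fin n → Bool
⁅ c ⁆ x = does (c ≟ x)

class : ∀ {p q} → (Fin p → Fin q) → Fin q → Fin p → Bool
class part i x = does (part x ≟ i)

witness : ∀ {A : Set} (d : Dec A) → does d ≡ true → A
witness (yes a) _ = a

∧-fst : ∀ {b c} → b ∧ c ≡ true → b ≡ true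
∧-fst {b} {c} = ∧-conicalˡ b c

∧-snd : ∀ {b c} → b ∧ c ≡ true → c ≡ true
∧-snd {b} {c} = ∧-conicalʳ b c

∧-intro : ∀ {b c} → b ≡ true → c ≡ true → b ∧ c ≡ true
∧-intro refl c≡true = c≡true

not-intro : ∀ {b} → b ≡ false → not b ≡ true
not-intro refl = refl

not-elim : ∀ {b} → not b ≡ true → b ≡ true → ⊥
not-elim {false} _ ()

∨-elim : ∀ {b c} → b ∨ c ≡ true → b ≡ true ⊎ c ≡ true
∨-elim {true}  _ = inj₁ refl
∨-elim {false} c≡true = inj₂ c≡true

∨-introˡ : ∀ {b c} → b ≡ true → b ∨ c ≡ true
∨-introˡ refl = refl

∨-introʳ : ∀ {b c} → c ≡ true → b ∨ c ≡ true
∨-introʳ {true}  _ = refl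
∨-introʳ {false} c≡true = c≡true

∈⁅⁆ : ∀ {n} (c : Fin n) {x} → x ∈ ⁅ c ⁆ → c ≡ x
∈⁅⁆ c {x} = witness (c ≟ x)

c∈⁅c⁆ : ∀ {n} (c : Fin n) → c ∈ ⁅ c ⁆
c∈⁅c⁆ c = dec-true (c ≟ c) refl

⁅⁆⊆ : ∀ {n} {P : Fin n → Bool} {x} → x ∈ P → ⁅ x ⁆ ⊆ P
⁅⁆⊆ {P = P} {x} x∈P y y∈⁅x⁆ = subst (_∈ P) (∈⁅⁆ x y∈⁅x⁆) x∈P

∈-own-class : ∀ {p q} (part : Fin p → Fin q) x → x ∈ class part (part x)
∈-own-class part x = c∈⁅c⁆ (part x)

∈-class : ∀ {p q} (part : Fin p → Fin q) {i x} → x ∈ class part i → part x ≡ i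
∈-class part {i} {x} = witness (part x ≟ i)

searchSubsets : ∀ {n} {P : (Fin n → Bool) → Set} →
  (∀ S → Dec (P S)) → (∀ S S′ → (∀ x → S x ≡ S′ x) → P S → P S′) →
  ∃ P ⊎ (∀ S → ¬ P S)
searchSubsets P? resp with anySubset? (P? ∘ lookup)
... | yes (V , PV) = inj₁ (lookup V , PV)
... | no ¬∃ = inj₂ λ S PS → ¬∃ (tabulate S , resp S _ (λ x → sym (lookup∘tabulate S x)) PS)

𝟙 : Bool → ℕ
𝟙 true  = 1
𝟙 false = 0

𝟙-∧ : ∀ b c → 𝟙 (b ∧ c) ≡ 𝟙 b * 𝟙 c
𝟙-∧ false c = refl
𝟙-∧ true  c = sym (*-identityˡ (𝟙 c))

𝟙-mono : ∀ {b c} → (b ≡ true → c ≡ true) → 𝟙 b ≤ 𝟙 c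
𝟙-mono {false} _ = z≤n
𝟙-mono {true}  b⇒c rewrite b⇒c refl = ≤-refl

𝟙-split : ∀ b c → 𝟙 b ≡ 𝟙 (b ∧ c) + 𝟙 (b ∧ not c)
𝟙-split false c     = refl
𝟙-split true  false = refl
𝟙-split true  true  = refl

sum-mono : ∀ {n} {f g : Fin n → ℕ} → (∀ x → f x ≤ g x) → ∑[ x < n ] f x ≤ ∑[ x < n ] g x
sum-mono {zero}  f≤g = z≤n
sum-mono {suc n} f≤g = +-mono-≤ (f≤g zero) (sum-mono (f≤g ∘ suc))

sum-point : ∀ {n} (c : Fin n) (h : Fin n → ℕ) → ∑[ y < n ] (𝟙 (⁅ c ⁆ y) * h y) ≡ h c
sum-point {suc n} zero h = begin
  h zero + 0 + ∑[ y < n ] 0  ≡⟨ cong (h zero + 0 +_) (sum-replicate-zero n) ⟩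
  h zero + 0 + 0              ≡⟨ +-identityʳ (h zero + 0) ⟩
  h zero + 0                  ≡⟨ +-identityʳ (h zero) ⟩
  h zero                      ∎
  where open ≡-Reasoning
sum-point {suc n} (suc c) h = sum-point c (h ∘ suc)

sum-by-classes : ∀ {p q} (part : Fin p → Fin q) (g : Fin p → ℕ) →
  ∑[ x < p ] g x ≡ ∑[ i < q ] ∑[ x < p ] (𝟙 (class part i x) * g x)
sum-by-classes part g = begin
  ∑[ x < _ ] g x                                    ≡⟨ sum-cong-≗ (λ x → sum-point (part x) (λ _ → g x)) ⟨
  ∑[ x < _ ] ∑[ i < _ ] (𝟙 (class part i x) * g x)    ≡⟨ ∑-comm (λ x i → 𝟙 (class part i x) * g x) ⟩
  ∑[ i < _ ] ∑[ x < _ ] (𝟙 (class part i x) * g x)    ∎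
  where open ≡-Reasoning

count-sum : ∀ {n} (P : Fin n → Bool) → count P ≡ ∑[ x < n ] 𝟙 (P x)
count-sum {zero}  P = refl
count-sum {suc n} P with P zero
... | true  = cong suc (count-sum (P ∘ suc))
... | false = count-sum (P ∘ suc)

sum-const-on : ∀ {n} (P : Fin n → Bool) (f : Fin n → ℕ) {c} → (∀ x → x ∈ P → f x ≡ c) →
  ∑[ x < n ] (𝟙 (P x) * f x) ≡ count P * c
sum-const-on {n} P f {c} f≡c = begin
  ∑[ x < n ] (𝟙 (P x) * f x)  ≡⟨ sum-cong-≗ on-P ⟩
  ∑[ x < n ] (𝟙 (P x) * c)   ≡⟨ *-distribʳ-sum c (λ x → 𝟙 (P x)) ⟨
  (∑[ x < n ] 𝟙 (P x)) * c  ≡⟨ cong (_* c) (count-sum P) ⟨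
  count P * c               ∎
  where
  open ≡-Reasoning
  on-P : ∀ x → 𝟙 (P x) * f x ≡ 𝟙 (P x) * c
  on-P x with P x in P≡
  ... | true  = cong (1 *_) (f≡c x P≡)
  ... | false = refl

count-mono : ∀ {n} {P Q : Fin n → Bool} → P ⊆ Q → count P ≤ count Q
count-mono {P = P} {Q} P⊆Q = subst₂ _≤_ (sym (count-sum P)) (sym (count-sum Q))
  (sum-mono (λ x → 𝟙-mono (P⊆Q x)))

count-cong : ∀ {n} {P Q : Fin n → Bool} → (∀ x → P x ≡ Q x) → count P ≡ count Q
count-cong P≗Q = ≤-antisym (count-mono λ x → trans (sym (P≗Q x))) (count-mono λ x → trans (P≗Q x))

count-split : ∀ {n} (P Q : Fin n → Bool) → count P ≡ count (P ∩ Q) + count (P ─ Q)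
count-split {n} P Q = begin
  count P                                               ≡⟨ count-sum P ⟩
  ∑[ x < n ] 𝟙 (P x)                                    ≡⟨ sum-cong-≗ (λ x → 𝟙-split (P x) (Q x)) ⟩
  ∑[ x < n ] (𝟙 ((P ∩ Q) x) + 𝟙 ((P ─ Q) x))            ≡⟨ ∑-distrib-+ (λ x → 𝟙 ((P ∩ Q) x)) (λ x → 𝟙 ((P ─ Q) x)) ⟩
  ∑[ x < n ] 𝟙 ((P ∩ Q) x) + ∑[ x < n ] 𝟙 ((P ─ Q) x)   ≡⟨ cong₂ _+_ (count-sum (P ∩ Q)) (count-sum (P ─ Q)) ⟨
  count (P ∩ Q) + count (P ─ Q)                         ∎
  where open ≡-Reasoning

count-⁅⁆ : ∀ {n} (c : Fin n) → count ⁅ c ⁆ ≡ 1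
count-⁅⁆ {n} c = begin
  count ⁅ c ⁆                     ≡⟨ count-sum ⁅ c ⁆ ⟩
  ∑[ y < n ] 𝟙 (⁅ c ⁆ y)          ≡⟨ sum-cong-≗ (λ y → *-identityʳ (𝟙 (⁅ c ⁆ y))) ⟨
  ∑[ y < n ] (𝟙 (⁅ c ⁆ y) * 1)     ≡⟨ sum-point c (λ _ → 1) ⟩
  1                               ∎
  where open ≡-Reasoning

count-pos : ∀ {n} (P : Fin n → Bool) {x} → x ∈ P → 1 ≤ count P
count-pos P {x} x∈P = ≤-trans (≤-reflexive (sym (count-⁅⁆ x))) (count-mono {P = ⁅ x ⁆} (⁅⁆⊆ x∈P))

count-≤ : ∀ {n} (P : Fin n → Bool) → count P ≤ n
count-≤ {zero}  P = z≤n
count-≤ {suc n} P with P zero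
... | true  = s≤s (count-≤ (P ∘ suc))
... | false = m≤n⇒m≤1+n (count-≤ (P ∘ suc))

count-witness : ∀ {n} (P : Fin n → Bool) → 1 ≤ count P → ∃[ x ] x ∈ P
count-witness {suc n} P |P|≥1 with P zero in P₀
... | true  = zero , P₀
... | false with x , x∈P ← count-witness (P ∘ suc) |P|≥1 = suc x , x∈P

count-─-< : ∀ {n} (P Q : Fin n → Bool) → Q ⊆ P → 1 ≤ count Q → count (P ─ Q) < count P
count-─-< P Q Q⊆P Q-nonempty = begin-strict
  count (P ─ Q)                  <⟨ m<n+m (count (P ─ Q)) (≤-trans Q-nonempty (count-mono Q⊆P∩Q)) ⟩
  count (P ∩ Q) + count (P ─ Q)  ≡⟨ count-split P Q ⟨
  count P                        ∎
  where
  open ≤-Reasoning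
  Q⊆P∩Q : Q ⊆ P ∩ Q
  Q⊆P∩Q x x∈Q = ∧-intro (Q⊆P x x∈Q) x∈Q

count-─-⁅⁆ : ∀ {n} (P : Fin n → Bool) (c : Fin n) → count P ≤ suc (count (P ─ ⁅ c ⁆))
count-─-⁅⁆ P c = begin
  count P                              ≡⟨ count-split P ⁅ c ⁆ ⟩
  count (P ∩ ⁅ c ⁆) + count (P ─ ⁅ c ⁆)  ≤⟨ +-monoˡ-≤ _ (count-mono {P = P ∩ ⁅ c ⁆} (λ _ → ∧-snd)) ⟩
  count ⁅ c ⁆ + count (P ─ ⁅ c ⁆)        ≡⟨ cong (_+ count (P ─ ⁅ c ⁆)) (count-⁅⁆ c) ⟩
  suc (count (P ─ ⁅ c ⁆))              ∎
  where open ≤-Reasoning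

count-∪ : ∀ {n} (P Q : Fin n → Bool) → (∀ x → x ∈ P → x ∈ Q → ⊥) → count P + count Q ≤ count (P ∪ Q)
count-∪ P Q disjoint = begin
  count P + count Q                            ≡⟨ +-comm (count P) (count Q) ⟩
  count Q + count P                            ≤⟨ +-mono-≤ (count-mono Q⊆) (count-mono P⊆) ⟩
  count ((P ∪ Q) ∩ Q) + count ((P ∪ Q) ─ Q)    ≡⟨ count-split (P ∪ Q) Q ⟨
  count (P ∪ Q)                                ∎
  where
  open ≤-Reasoning
  Q⊆ : Q ⊆ (P ∪ Q) ∩ Q
  Q⊆ x x∈Q = ∧-intro (∨-introʳ {P x} x∈Q) x∈Q
  P⊆ : P ⊆ (P ∪ Q) ─ Q
  P⊆ x x∈P = ∧-intro (∨-introˡ x∈P) (not-intro (¬-not (disjoint x x∈P)))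

𝟙-*-count : ∀ {n} b (Q : Fin n → Bool) → 𝟙 b * count Q ≡ ∑[ y < n ] 𝟙 (b ∧ Q y)
𝟙-*-count {n} b Q = begin
  𝟙 b * count Q                  ≡⟨ cong (𝟙 b *_) (count-sum Q) ⟩
  𝟙 b * ∑[ y < n ] 𝟙 (Q y)       ≡⟨ *-distribˡ-sum (𝟙 b) (λ y → 𝟙 (Q y)) ⟩
  ∑[ y < n ] (𝟙 b * 𝟙 (Q y))     ≡⟨ sum-cong-≗ (λ y → 𝟙-∧ b (Q y)) ⟨
  ∑[ y < n ] 𝟙 (b ∧ Q y)         ∎
  where open ≡-Reasoning

edge-count-≤ : ∀ {m n} (E : Fin m → Fin n → Bool) (P P′ : Fin m → Bool) (Q Q′ : Fin n → Bool) →
  (∀ x y → x ∈ P → y ∈ Q → E x y ≡ true → x ∈ P′ × y ∈ Q′) →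
  ∑[ x < m ] (𝟙 (P x) * count (Q ∩ E x)) ≤ ∑[ y < n ] (𝟙 (Q′ y) * count (P′ ∩ λ x → E x y))
edge-count-≤ {m} {n} E P P′ Q Q′ edge⇒edge = begin
  ∑[ x < m ] (𝟙 (P x) * count (Q ∩ E x))              ≡⟨ sum-cong-≗ (λ x → 𝟙-*-count (P x) (Q ∩ E x)) ⟩
  ∑[ x < m ] ∑[ y < n ] 𝟙 (P x ∧ (Q y ∧ E x y))       ≤⟨ sum-mono (λ x → sum-mono (λ y → 𝟙-mono (counted x y))) ⟩
  ∑[ x < m ] ∑[ y < n ] 𝟙 (Q′ y ∧ (P′ x ∧ E x y))     ≡⟨ ∑-comm (λ x y → 𝟙 (Q′ y ∧ (P′ x ∧ E x y))) ⟩
  ∑[ y < n ] ∑[ x < m ] 𝟙 (Q′ y ∧ (P′ x ∧ E x y))     ≡⟨ sum-cong-≗ (λ y → 𝟙-*-count (Q′ y) (P′ ∩ λ x → E x y)) ⟨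
  ∑[ y < n ] (𝟙 (Q′ y) * count (P′ ∩ λ x → E x y))    ∎
  where
  open ≤-Reasoning
  counted : ∀ x y → P x ∧ (Q y ∧ E x y) ≡ true → Q′ y ∧ (P′ x ∧ E x y) ≡ true
  counted x y e with edge⇒edge x y (∧-fst e) (∧-fst (∧-snd {P x} e)) (∧-snd (∧-snd {P x} e))
  ... | x∈P′ , y∈Q′ = ∧-intro y∈Q′ (∧-intro x∈P′ (∧-snd (∧-snd {P x} e)))

Nbh : ∀ {m n} → (Fin m → Fin n → Bool) → (Fin m → Bool) → Fin n → Bool
Nbh E S y = does (any? λ x → (S x ∧ E x y) ≟ᵇ true)

module Neighbourhood {m n : ℕ} (E : Fin m → Fin n → Bool) where

  Nbh-intro : ∀ {S x y} → x ∈ S → E x y ≡ true → y ∈ Nbh E S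
  Nbh-intro {x = x} x∈S e = dec-true (any? _) (x , ∧-intro x∈S e)

  Nbh-elim : ∀ {S y} → y ∈ Nbh E S → ∃[ x ] (x ∈ S × E x y ≡ true)
  Nbh-elim {S} y∈N with x , e ← witness (any? _) y∈N = x , ∧-fst e , ∧-snd {S x} e

  Nbh-mono : ∀ {S S′} → S ⊆ S′ → Nbh E S ⊆ Nbh E S′
  Nbh-mono S⊆S′ y y∈N with x , x∈S , e ← Nbh-elim y∈N = Nbh-intro (S⊆S′ x x∈S) e

-- Matchings are total functions whose values
-- outside A do not matter; `fallback` supplies those values when A is empty.
module Hall {m n : ℕ} (E : Fin m → Fin n → Bool) (fallback : Fin m → Fin n) where

  open Neighbourhood E

  N : (Fin m → Bool) → Fin n → Bool
  N = Nbh E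

  HallCondition : (Fin m → Bool) → (Fin n → Bool) → Set
  HallCondition A B = ∀ S → S ⊆ A → count S ≤ count (B ∩ N S)

  Matching : (Fin m → Bool) → (Fin n → Bool) → Set
  Matching A B = Σ (Fin m → Fin n) λ f →
      (∀ x → x ∈ A → f x ∈ B × E x (f x) ≡ true)
    × (∀ x x′ → x ∈ A → x′ ∈ A → f x ≡ f x′ → x ≡ x′)

  Tight : (Fin m → Bool) → (Fin n → Bool) → (Fin m → Bool) → Set
  Tight A B S = S ⊆ A × 1 ≤ count S × count S < count A × count (B ∩ N S) ≤ count S

  Tight? : ∀ A B S → Dec (Tight A B S)
  Tight? A B S = all? (λ x → (S x ≟ᵇ true) →-dec (A x ≟ᵇ true))
    ×-dec 1 ≤? count S ×-dec count S <? count A ×-dec count (B ∩ N S) ≤? count S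

  Tight-ext : ∀ A B S S′ → (∀ x → S x ≡ S′ x) → Tight A B S → Tight A B S′
  Tight-ext A B S S′ S≗S′ (S⊆A , nonempty , proper , tight) =
      (λ x x∈S′ → S⊆A x (S′⊆S x x∈S′))
    , subst (1 ≤_) |S|≡|S′| nonempty
    , subst (_< count A) |S|≡|S′| proper
    , ≤-trans (count-mono (λ y y∈ → ∧-intro (∧-fst y∈) (Nbh-mono S′⊆S y (∧-snd {B y} y∈))))
              (≤-trans tight (≤-reflexive |S|≡|S′|))
    where
    |S|≡|S′| : count S ≡ count S′
    |S|≡|S′| = count-cong S≗S′
    S′⊆S : S′ ⊆ S
    S′⊆S x x∈S′ = trans (S≗S′ x) x∈S′

  match-empty : ∀ {A} B → (∀ x → x ∈ A → ⊥) → Matching A B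
  match-empty B A-empty = fallback , (λ x x∈A → ⊥-elim (A-empty x x∈A)) , (λ x _ x∈A _ _ → ⊥-elim (A-empty x x∈A))

  match-edge : ∀ {x₀ y₀} → E x₀ y₀ ≡ true → Matching ⁅ x₀ ⁆ ⁅ y₀ ⁆
  match-edge {x₀} {y₀} e =
      (λ _ → y₀)
    , (λ x x∈⁅x₀⁆ → c∈⁅c⁆ y₀ , subst (λ z → E z y₀ ≡ true) (∈⁅⁆ x₀ x∈⁅x₀⁆) e)
    , (λ x x′ x∈⁅x₀⁆ x′∈⁅x₀⁆ _ → trans (sym (∈⁅⁆ x₀ x∈⁅x₀⁆)) (∈⁅⁆ x₀ x′∈⁅x₀⁆))

  glue : ∀ {A B S B₁ B₂} → B₁ ⊆ B → B₂ ⊆ B → (∀ y → y ∈ B₁ → y ∈ B₂ → ⊥) →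
    Matching S B₁ → Matching (A ─ S) B₂ → Matching A B
  glue {A} {B} {S} {B₁} {B₂} B₁⊆B B₂⊆B disjoint (f₁ , f₁-ok , f₁-inj) (f₂ , f₂-ok , f₂-inj) =
    f , f-ok , f-inj
    where
    f : Fin m → Fin n
    f x = if S x then f₁ x else f₂ x

    f-ok : ∀ x → x ∈ A → f x ∈ B × E x (f x) ≡ true
    f-ok x x∈A with S x in S≡
    ... | true  with f₁x∈B₁ , e ← f₁-ok x S≡ = B₁⊆B _ f₁x∈B₁ , e
    ... | false with f₂x∈B₂ , e ← f₂-ok x (∧-intro x∈A (not-intro S≡)) = B₂⊆B _ f₂x∈B₂ , e

    separate : ∀ {x x′} → x ∈ S → x′ ∈ A ─ S → f₁ x ≡ f₂ x′ → ⊥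
    separate x∈S x′∈A─S f₁x≡f₂x′ =
      disjoint _ (proj₁ (f₁-ok _ x∈S)) (subst (_∈ B₂) (sym f₁x≡f₂x′) (proj₁ (f₂-ok _ x′∈A─S)))

    f-inj : ∀ x x′ → x ∈ A → x′ ∈ A → f x ≡ f x′ → x ≡ x′
    f-inj x x′ x∈A x′∈A fx≡fx′ with S x in S≡ | S x′ in S≡′
    ... | true  | true  = f₁-inj x x′ S≡ S≡′ fx≡fx′
    ... | false | false = f₂-inj x x′ (∧-intro x∈A (not-intro S≡)) (∧-intro x′∈A (not-intro S≡′)) fx≡fx′
    ... | true  | false = ⊥-elim (separate S≡ (∧-intro x′∈A (not-intro S≡′)) fx≡fx′)
    ... | false | true  = ⊥-elim (separate S≡′ (∧-intro x∈A (not-intro S≡)) (sym fx≡fx′))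

  glue-tight : ∀ {A B S} → Matching S (B ∩ N S) → Matching (A ─ S) (B ─ N S) → Matching A B
  glue-tight {A} {B} {S} = glue {A} {B} {S} {B ∩ N S} {B ─ N S} (λ _ → ∧-fst) (λ _ → ∧-fst)
    (λ y y∈N y∉N → not-elim (∧-snd {B y} y∉N) (∧-snd {B y} y∈N))

  glue-edge : ∀ {A B x₀ y₀} → y₀ ∈ B → E x₀ y₀ ≡ true → Matching (A ─ ⁅ x₀ ⁆) (B ─ ⁅ y₀ ⁆) → Matching A B
  glue-edge {A} {B} {x₀} {y₀} y₀∈B x₀y₀ = glue {A} {B} {⁅ x₀ ⁆} {⁅ y₀ ⁆} {B ─ ⁅ y₀ ⁆} (⁅⁆⊆ y₀∈B) (λ _ → ∧-fst)
    (λ y y∈⁅y₀⁆ y∈B─y₀ → not-elim (∧-snd {B y} y∈B─y₀) y∈⁅y₀⁆) (match-edge x₀y₀)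

  hall-neighbour : ∀ {A B x₀} → HallCondition A B → x₀ ∈ A → ∃[ y₀ ] (y₀ ∈ B × E x₀ y₀ ≡ true)
  hall-neighbour {A} {B} {x₀} hc x₀∈A
    with y₀ , y₀∈B∩N ← count-witness (B ∩ N ⁅ x₀ ⁆) (≤-trans (count-pos ⁅ x₀ ⁆ (c∈⁅c⁆ x₀)) (hc ⁅ x₀ ⁆ (⁅⁆⊆ x₀∈A)))
    with x , x∈⁅x₀⁆ , xy₀ ← Nbh-elim (∧-snd {B y₀} y₀∈B∩N)
    = y₀ , ∧-fst y₀∈B∩N , subst (λ z → E z y₀ ≡ true) (sym (∈⁅⁆ x₀ x∈⁅x₀⁆)) xy₀

  hall-inside : ∀ {A B S} → HallCondition A B → S ⊆ A → HallCondition S (B ∩ N S)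
  hall-inside {B = B} hc S⊆A S′ S′⊆S = ≤-trans (hc S′ (λ x → S⊆A x ∘ S′⊆S x))
    (count-mono λ y y∈ → ∧-intro (∧-intro (∧-fst y∈) (Nbh-mono S′⊆S y (∧-snd {B y} y∈))) (∧-snd {B y} y∈))

  -- If S ⊆ A is tight, Hall's condition passes to A ─ S matched into B ─ N(S):
  -- for S′ ⊆ A ─ S,  |S′| + |S| ≤ |B ∩ N(S′ ∪ S)| ≤ |B ∩ N(S)| + |(B ─ N(S)) ∩ N(S′)|.
  hall-outside : ∀ {A B S} → HallCondition A B → S ⊆ A → count (B ∩ N S) ≤ count S →
    HallCondition (A ─ S) (B ─ N S)
  hall-outside {A} {B} {S} hc S⊆A tight S′ S′⊆A─S = +-cancelʳ-≤ (count S) _ _ (begin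
    count S′ + count S                                ≤⟨ count-∪ S′ S S′∩S=∅ ⟩
    count (S′ ∪ S)                                    ≤⟨ hc (S′ ∪ S) S′∪S⊆A ⟩
    count (B ∩ N (S′ ∪ S))                            ≡⟨ count-split (B ∩ N (S′ ∪ S)) (N S) ⟩
    count ((B ∩ N (S′ ∪ S)) ∩ N S) + count ((B ∩ N (S′ ∪ S)) ─ N S)
                                                      ≤⟨ +-mono-≤ (≤-trans (count-mono into-N) tight) (count-mono outside-N) ⟩
    count S + count ((B ─ N S) ∩ N S′)                ≡⟨ +-comm (count S) _ ⟩
    count ((B ─ N S) ∩ N S′) + count S                ∎)
    where
    open ≤-Reasoning
    S′∩S=∅ : ∀ x → x ∈ S′ → x ∈ S → ⊥
    S′∩S=∅ x x∈S′ = not-elim (∧-snd {A x} (S′⊆A─S x x∈S′))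
    S′∪S⊆A : S′ ∪ S ⊆ A
    S′∪S⊆A x x∈ with ∨-elim {S′ x} x∈
    ... | inj₁ x∈S′ = ∧-fst (S′⊆A─S x x∈S′)
    ... | inj₂ x∈S  = S⊆A x x∈S
    into-N : (B ∩ N (S′ ∪ S)) ∩ N S ⊆ B ∩ N S
    into-N y y∈ = ∧-intro (∧-fst (∧-fst y∈)) (∧-snd {B y ∧ N (S′ ∪ S) y} y∈)
    outside-N : (B ∩ N (S′ ∪ S)) ─ N S ⊆ (B ─ N S) ∩ N S′
    outside-N y y∈ with Nbh-elim (∧-snd {B y} (∧-fst y∈))
    ... | x , x∈S′∪S , e with ∨-elim {S′ x} x∈S′∪S
    ...   | inj₁ x∈S′ = ∧-intro (∧-intro (∧-fst (∧-fst y∈)) (∧-snd {B y ∧ N (S′ ∪ S) y} y∈)) (Nbh-intro x∈S′ e)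
    ...   | inj₂ x∈S  = ⊥-elim (not-elim (∧-snd {B y ∧ N (S′ ∪ S) y} y∈) (Nbh-intro x∈S e))

  -- If no subset of A is tight, Hall's condition survives removing any x₀ ∈ A
  -- from A and any y₀ from B: every nonempty S ⊆ A ─ {x₀} has a surplus neighbour.
  hall-after-edge : ∀ {A B x₀} y₀ → HallCondition A B → (∀ S → ¬ Tight A B S) → x₀ ∈ A →
    HallCondition (A ─ ⁅ x₀ ⁆) (B ─ ⁅ y₀ ⁆)
  hall-after-edge {A} {B} {x₀} y₀ hc no-tight x₀∈A S S⊆A′ with 1 ≤? count S
  ... | no  S-empty = ≤-trans (≤-pred (≰⇒> S-empty)) z≤n
  ... | yes S-nonempty = ≤-pred (begin-strict
    count S                              <⟨ ≰⇒> (λ S-tight → no-tight S (S⊆A , S-nonempty , S<A , S-tight)) ⟩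
    count (B ∩ N S)                      ≤⟨ count-─-⁅⁆ (B ∩ N S) y₀ ⟩
    suc (count ((B ∩ N S) ─ ⁅ y₀ ⁆))      ≤⟨ s≤s (count-mono reorder) ⟩
    suc (count ((B ─ ⁅ y₀ ⁆) ∩ N S))      ∎)
    where
    open ≤-Reasoning
    S⊆A : S ⊆ A
    S⊆A x x∈S = ∧-fst (S⊆A′ x x∈S)
    S<A : count S < count A
    S<A = ≤-<-trans (count-mono S⊆A′) (count-─-< A ⁅ x₀ ⁆ (⁅⁆⊆ x₀∈A) (count-pos ⁅ x₀ ⁆ (c∈⁅c⁆ x₀)))
    reorder : (B ∩ N S) ─ ⁅ y₀ ⁆ ⊆ (B ─ ⁅ y₀ ⁆) ∩ N S
    reorder y y∈ = ∧-intro (∧-intro (∧-fst (∧-fst y∈)) (∧-snd {B y ∧ N S y} y∈)) (∧-snd {B y} (∧-fst y∈))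

  -- Hall's theorem, by induction on an upper bound F of |A|: split A along a
  -- tight set if there is one, and otherwise match any x₀ ∈ A to any neighbour.
  hall : ∀ F {A B} → count A ≤ F → HallCondition A B → Matching A B
  hall zero {A} {B} |A|≤0 hc = match-empty B (λ x x∈A → 1+n≰n (≤-trans (count-pos A x∈A) |A|≤0))
  hall (suc F) {A} {B} |A|≤1+F hc with any? (λ x → A x ≟ᵇ true)
  ... | no A-empty = match-empty B (λ x x∈A → A-empty (x , x∈A))
  ... | yes (x₀ , x₀∈A) with searchSubsets (Tight? A B) (Tight-ext A B)
  ... | inj₁ (S , S⊆A , S-nonempty , S<A , tight) = glue-tight {A} {B} {S}
    (hall F (m<1+n⇒m≤n (<-≤-trans S<A |A|≤1+F)) (hall-inside hc S⊆A))
    (hall F (m<1+n⇒m≤n (<-≤-trans (count-─-< A S S⊆A S-nonempty) |A|≤1+F)) (hall-outside hc S⊆A tight))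
  ... | inj₂ no-tight with y₀ , y₀∈B , x₀y₀ ← hall-neighbour hc x₀∈A = glue-edge {A} {B} y₀∈B x₀y₀
    (hall F (m<1+n⇒m≤n (<-≤-trans (count-─-< A ⁅ x₀ ⁆ (⁅⁆⊆ x₀∈A) (count-pos ⁅ x₀ ⁆ (c∈⁅c⁆ x₀))) |A|≤1+F))
      (hall-after-edge y₀ hc no-tight x₀∈A))

module _ {m n : ℕ} {R : Fin m → Fin n → Set} where

  matching⇒permutation : PerfectMatching R → Σ (Permutation m n) λ σ → ∀ x → R x (σ ⟨$⟩ʳ x)
  matching⇒permutation (M , M⊆R , cover-A , cover-B) =
    permutation to from to∘from from∘to , λ x → M⊆R x (to x) (proj₁ (proj₂ (cover-A x)))
    where
    to : Fin m → Fin n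
    to x = proj₁ (cover-A x)
    from : Fin n → Fin m
    from y = proj₁ (cover-B y)
    to∘from : ∀ y → to (from y) ≡ y
    to∘from y = sym (proj₂ (proj₂ (cover-A (from y))) y (proj₁ (proj₂ (cover-B y))))
    from∘to : ∀ x → from (to x) ≡ x
    from∘to x = sym (proj₂ (proj₂ (cover-B (to x))) x (proj₁ (proj₂ (cover-A x))))

  permutation⇒matching : (σ : Permutation m n) → (∀ x → R x (σ ⟨$⟩ʳ x)) → PerfectMatching R
  permutation⇒matching σ σ⊆R =
      (λ x y → σ ⟨$⟩ʳ x ≡ y)
    , (λ x y σx≡y → subst (R x) σx≡y (σ⊆R x))
    , (λ x → σ ⟨$⟩ʳ x , refl , λ y σx≡y → sym σx≡y)
    , (λ y → σ ⟨$⟩ˡ y , inverseʳ σ , λ x σx≡y → trans (sym (inverseˡ σ)) (cong (σ ⟨$⟩ˡ_) σx≡y))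

injective⇒surjective : ∀ {m n} → m ≡ n → (f : Fin m → Fin n) → Injective _≡_ _≡_ f → ∀ y → ∃[ x ] f x ≡ y
injective⇒surjective {m} {suc n} refl f f-inj y with any? (λ x → f x ≟ y)
... | yes hit = hit
... | no  miss = contradiction (injective⇒≤ f-punchOut-inj) 1+n≰n
  where
  -- if f misses y it factors injectively through Fin (suc n) ∖ {y} ≅ Fin n,
  -- which is too small
  f-punchOut : Fin (suc n) → Fin n
  f-punchOut x = punchOut {i = y} {j = f x} (λ y≡fx → miss (x , sym y≡fx))
  f-punchOut-inj : Injective _≡_ _≡_ f-punchOut
  f-punchOut-inj = f-inj ∘ punchOut-injective {i = y} _ _

injective⇒permutation : ∀ {m n} → m ≡ n → (f : Fin m → Fin n) → Injective _≡_ _≡_ f →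
  Σ (Permutation m n) λ σ → ∀ x → σ ⟨$⟩ʳ x ≡ f x
injective⇒permutation {m} {n} m≡n f f-inj = permutation f from f∘from from∘f , λ _ → refl
  where
  from : Fin n → Fin m
  from y = proj₁ (injective⇒surjective m≡n f f-inj y)
  f∘from : ∀ y → f (from y) ≡ y
  f∘from y = proj₂ (injective⇒surjective m≡n f f-inj y)
  from∘f : ∀ x → from (f x) ≡ x
  from∘f x = f-inj (f∘from (f x))

-- L ÷ r is L / r, with L ÷ 0 = 0 (it is only ever multiplied by a count ≤ r)
infixl 7 _÷_
_÷_ : ℕ → ℕ → ℕ
L ÷ zero  = 0
L ÷ suc r = L / suc r

-- r divides N! for 1 ≤ r ≤ N, so the division is exact
÷-cancel : ∀ N {s r} → s ≤ r → r ≤ N → s * (N ! ÷ r) * r ≡ s * N !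
÷-cancel N {s} {zero}  s≤0 _ rewrite n≤0⇒n≡0 s≤0 = refl
÷-cancel N {s} {suc r} _ r<N = begin
  s * (N ! / suc r) * suc r    ≡⟨ *-assoc s _ (suc r) ⟩
  s * (N ! / suc r * suc r)    ≡⟨ cong (s *_) (m/n*n≡m (∣-trans (m∣m*n (r !)) (m≤n⇒m!∣n! r<N))) ⟩
  s * N !                      ∎
  where open ≡-Reasoning

-- Weights of S ⊆ Fin p in the partition of Fin p with classes P_i = part⁻¹(i):
-- weight i = N! · |S ∩ P_i| / |P_i|, an integer for N ≥ p.  Giving each x the
-- weight of its class spreads |S| · N! evenly over the classes.
module Weights {p q : ℕ} (part : Fin p → Fin q) (S : Fin p → Bool) (N : ℕ) (p≤N : p ≤ N) where

  size : Fin q → ℕ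
  size i = count (class part i)

  hits : Fin q → ℕ
  hits i = count (S ∩ class part i)

  weight : Fin q → ℕ
  weight i = hits i * (N ! ÷ size i)

  weight-spec : ∀ i → weight i * size i ≡ hits i * N !
  weight-spec i = ÷-cancel N (count-mono {P = S ∩ class part i} (λ _ → ∧-snd)) (≤-trans (count-≤ (class part i)) p≤N)

  total-hits : ∑[ i < q ] hits i ≡ count S
  total-hits = begin
    ∑[ i < q ] hits i                                   ≡⟨ sum-cong-≗ (λ i → count-sum (S ∩ class part i)) ⟩
    ∑[ i < q ] ∑[ x < p ] 𝟙 (S x ∧ class part i x)      ≡⟨ sum-cong-≗ (λ i → sum-cong-≗ (λ x → 𝟙-∧-comm (S x) (class part i x))) ⟩
    ∑[ i < q ] ∑[ x < p ] (𝟙 (class part i x) * 𝟙 (S x)) ≡⟨ sum-by-classes part (λ x → 𝟙 (S x)) ⟨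
    ∑[ x < p ] 𝟙 (S x)                                  ≡⟨ count-sum S ⟨
    count S                                             ∎
    where
    open ≡-Reasoning
    𝟙-∧-comm : ∀ b c → 𝟙 (b ∧ c) ≡ 𝟙 c * 𝟙 b
    𝟙-∧-comm b c = trans (𝟙-∧ b c) (*-comm (𝟙 b) (𝟙 c))

  total-weight : ∑[ x < p ] weight (part x) ≡ count S * N !
  total-weight = begin
    ∑[ x < p ] weight (part x)                                  ≡⟨ sum-by-classes part (weight ∘ part) ⟩
    ∑[ i < q ] ∑[ x < p ] (𝟙 (class part i x) * weight (part x)) ≡⟨ sum-cong-≗ (λ i → sum-const-on (class part i) (weight ∘ part) (λ x → cong weight ∘ ∈-class part)) ⟩
    ∑[ i < q ] (size i * weight i)                              ≡⟨ sum-cong-≗ (λ i → trans (*-comm (size i) (weight i)) (weight-spec i)) ⟩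
    ∑[ i < q ] (hits i * N !)                                   ≡⟨ *-distribʳ-sum (N !) hits ⟨
    (∑[ i < q ] hits i) * N !                                   ≡⟨ cong (_* N !) total-hits ⟩
    count S * N !                                               ∎
    where open ≡-Reasoning

density-step : ∀ s r τ c d e → 1 ≤ e → s * d ≤ τ * e → c * e ≤ r * d → s * c ≤ τ * r
density-step s r τ c d e e≥1 sd≤τe ce≤rd = *-cancelʳ-≤ (s * c) (τ * r) e {{>-nonZero e≥1}} (begin
  s * c * e    ≡⟨ *-assoc s c e ⟩
  s * (c * e)  ≤⟨ *-monoʳ-≤ s ce≤rd ⟩
  s * (r * d)  ≡⟨ solve 3 (λ s r d → s :* (r :* d) := r :* (s :* d)) refl s r d ⟩
  r * (s * d)  ≤⟨ *-monoʳ-≤ r sd≤τe ⟩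
  r * (τ * e)  ≡⟨ solve 3 (λ r τ e → r :* (τ :* e) := τ :* r :* e) refl r τ e ⟩
  τ * r * e    ∎)
  where
  open ≤-Reasoning
  open +-*-Solver

scaled-≤ : ∀ s r τ c w w′ L → 1 ≤ r → 1 ≤ c → w * r ≡ s * L → w′ * c ≡ τ * L → s * c ≤ τ * r → w ≤ w′
scaled-≤ s r τ c w w′ L r≥1 c≥1 wr≡sL w′c≡τL sc≤τr =
  *-cancelʳ-≤ w w′ (r * c) {{>-nonZero (*-mono-≤ r≥1 c≥1)}} (begin
    w * (r * c)   ≡⟨ *-assoc w r c ⟨
    w * r * c     ≡⟨ cong (_* c) wr≡sL ⟩
    s * L * c     ≡⟨ solve 3 (λ s L c → s :* L :* c := s :* c :* L) refl s L c ⟩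
    s * c * L     ≤⟨ *-monoˡ-≤ L sc≤τr ⟩
    τ * r * L     ≡⟨ solve 3 (λ τ r L → τ :* r :* L := τ :* L :* r) refl τ r L ⟩
    τ * L * r     ≡⟨ cong (_* r) w′c≡τL ⟨
    w′ * c * r    ≡⟨ solve 3 (λ w′ c r → w′ :* c :* r := w′ :* (r :* c)) refl w′ c r ⟩
    w′ * (r * c)  ∎)
  where
  open ≤-Reasoning
  open +-*-Solver

-- With d, e the degrees in the block, the edges leaving S ∩ A_i give
-- |S ∩ A_i| · d ≤ |N(S) ∩ B_j| · e, and the edges of the block give |B_j| · e ≤ |A_i| · d.
block-density : ∀ {m n k l} (E : Fin m → Fin n → Bool) (a : Fin m → Fin k) (b : Fin n → Fin l) →
  BlockBiregular E a b → (S : Fin m → Bool) → ∀ {x′ y′} → E x′ y′ ≡ true →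
  count (S ∩ class a (a x′)) * count (class b (b y′)) ≤ count (Nbh E S ∩ class b (b y′)) * count (class a (a x′))
block-density {m} {n} E a b (regular-A , regular-B) S {x′} {y′} x′y′ =
  density-step (count (S ∩ Aᵢ)) (count Aᵢ) (count (Nbh E S ∩ Bⱼ)) (count Bⱼ) d e e≥1 from-S into-Bⱼ
  where
  open Neighbourhood E
  Aᵢ : Fin m → Bool
  Aᵢ = class a (a x′)
  Bⱼ : Fin n → Bool
  Bⱼ = class b (b y′)
  d e : ℕ
  d = degA E b x′ (b y′)
  e = degB E a y′ (a x′)
  degA≡d : ∀ x → x ∈ Aᵢ → degA E b x (b y′) ≡ d
  degA≡d x x∈Aᵢ = regular-A (a x′) (b y′) x x′ (∈-class a x∈Aᵢ) refl
  degB≡e : ∀ y → y ∈ Bⱼ → degB E a y (a x′) ≡ e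
  degB≡e y y∈Bⱼ = regular-B (a x′) (b y′) y y′ (∈-class b y∈Bⱼ) refl
  e≥1 : 1 ≤ e
  e≥1 = count-pos (Aᵢ ∩ λ x → E x y′) (∧-intro (∈-own-class a x′) x′y′)
  from-S : count (S ∩ Aᵢ) * d ≤ count (Nbh E S ∩ Bⱼ) * e
  from-S = subst₂ _≤_
    (sum-const-on (S ∩ Aᵢ) (λ x → degA E b x (b y′)) (λ x x∈ → degA≡d x (∧-snd {S x} x∈)))
    (sum-const-on (Nbh E S ∩ Bⱼ) (λ y → degB E a y (a x′)) (λ y y∈ → degB≡e y (∧-snd {Nbh E S y} y∈)))
    (edge-count-≤ E (S ∩ Aᵢ) Aᵢ Bⱼ (Nbh E S ∩ Bⱼ)
      (λ x y x∈ y∈Bⱼ xy → ∧-snd {S x} x∈ , ∧-intro (Nbh-intro (∧-fst x∈) xy) y∈Bⱼ))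
  into-Bⱼ : count Bⱼ * e ≤ count Aᵢ * d
  into-Bⱼ = subst₂ _≤_
    (sum-const-on Bⱼ (λ y → degB E a y (a x′)) degB≡e)
    (sum-const-on Aᵢ (λ x → degA E b x (b y′)) degA≡d)
    (edge-count-≤ (λ y x → E x y) Bⱼ Bⱼ Aᵢ Aᵢ (λ y x y∈Bⱼ x∈Aᵢ _ → y∈Bⱼ , x∈Aᵢ))

-- Give x ∈ A the weight of S in the class of x and y ∈ B the
-- weight of N_G(S) in the class of y; x and σ x lie in a block with an edge, so
--   |S|·L = Σ_x w_A(a x) ≤ Σ_x w_B(b (σ x)) = Σ_y w_B(b y) = |N_G(S)|·L.
hall-condition-G : ∀ {m n k l} (E : Fin m → Fin n → Bool) (a : Fin m → Fin k) (b : Fin n → Fin l) →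
  BlockBiregular E a b → (σ : Permutation m n) → (∀ x → HAdj E a b x (σ ⟨$⟩ʳ x)) →
  ∀ S → count S ≤ count (Nbh E S)
hall-condition-G {m} {n} E a b regular σ σ⊆H S =
  *-cancelʳ-≤ (count S) (count (Nbh E S)) L {{(m + n) !≢0}} (begin
    count S * L                            ≡⟨ WA.total-weight ⟨
    ∑[ x < m ] WA.weight (a x)             ≤⟨ sum-mono weight-≤ ⟩
    ∑[ x < m ] WB.weight (b (σ ⟨$⟩ʳ x))    ≡⟨ ∑-permute (WB.weight ∘ b) σ ⟨
    ∑[ y < n ] WB.weight (b y)             ≡⟨ WB.total-weight ⟩
    count (Nbh E S) * L                    ∎)
  where
  open ≤-Reasoning
  L : ℕ
  L = (m + n) !
  module WA = Weights a S (m + n) (m≤m+n m n)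
  module WB = Weights b (Nbh E S) (m + n) (m≤n+m n m)
  on-edge : ∀ {x′ y′} → E x′ y′ ≡ true → WA.weight (a x′) ≤ WB.weight (b y′)
  on-edge {x′} {y′} x′y′ =
    scaled-≤ (WA.hits (a x′)) (WA.size (a x′)) (WB.hits (b y′)) (WB.size (b y′))
      (WA.weight (a x′)) (WB.weight (b y′)) L
      (count-pos (class a (a x′)) (∈-own-class a x′)) (count-pos (class b (b y′)) (∈-own-class b y′))
      (WA.weight-spec (a x′)) (WB.weight-spec (b y′)) (block-density E a b regular S x′y′)
  weight-≤ : ∀ x → WA.weight (a x) ≤ WB.weight (b (σ ⟨$⟩ʳ x))
  weight-≤ x with x′ , y′ , ax′≡ax , by′≡bσx , x′y′ ← σ⊆H x =
    subst₂ (λ i j → WA.weight i ≤ WB.weight j) ax′≡ax by′≡bσx (on-edge x′y′)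

hall-perfect : ∀ {m n} (E : Fin m → Fin n → Bool) → m ≡ n → (∀ S → count S ≤ count (Nbh E S)) →
  PerfectMatching (GAdj E)
hall-perfect {m} {n} E m≡n hall-condition = permutation⇒matching σ σ⊆G
  where
  open Hall E (cast m≡n)
  A-into-B : Matching (λ _ → true) (λ _ → true)
  A-into-B = hall m (count-≤ _) (λ S _ → hall-condition S)
  f : Fin m → Fin n
  f = proj₁ A-into-B
  f-along-E : ∀ x → E x (f x) ≡ true
  f-along-E x = proj₂ (proj₁ (proj₂ A-into-B) x refl)
  σ-is-f : Σ (Permutation m n) λ σ → ∀ x → σ ⟨$⟩ʳ x ≡ f x
  σ-is-f = injective⇒permutation m≡n f (proj₂ (proj₂ A-into-B) _ _ refl refl)
  σ : Permutation m n
  σ = proj₁ σ-is-f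
  σ⊆G : ∀ x → GAdj E x (σ ⟨$⟩ʳ x)
  σ⊆G x = subst (λ y → E x y ≡ true) (sym (proj₂ σ-is-f x)) (f-along-E x)

matching-mono : ∀ {m n} {R R′ : Fin m → Fin n → Set} → (∀ x y → R x y → R′ x y) →
  PerfectMatching R → PerfectMatching R′
matching-mono R⊆R′ (M , M⊆R , cover-A , cover-B) = M , (λ x y → R⊆R′ x y ∘ M⊆R x y) , cover-A , cover-B

lemma2p1 : (m n k l : ℕ) (E : Fin m → Fin n → Bool) (a : Fin m → Fin k) (b : Fin n → Fin l) →
    BlockBiregular E a b →
    (PerfectMatching (GAdj E) → PerfectMatching (HAdj E a b))
      × (PerfectMatching (HAdj E a b) → PerfectMatching (GAdj E))
lemma2p1 m n k l E a b regular = G⇒H , H⇒G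
  where
  G⇒H : PerfectMatching (GAdj E) → PerfectMatching (HAdj E a b)
  G⇒H = matching-mono (λ x y xy → x , y , refl , refl , xy)

  H⇒G : PerfectMatching (HAdj E a b) → PerfectMatching (GAdj E)
  H⇒G H-matching with σ , σ⊆H ← matching⇒permutation H-matching =
    hall-perfect E (↔⇒≡ σ) (hall-condition-G E a b regular σ σ⊆H)
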